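{- Let $p$ be a prime and let $(\Omega,S)$ be a coherent configuration with fibers $\Omega_1,\dots,\Omega_m$ such that $(\Omega_i,S_i)\simeq C_p\wr C_p$ for each $i$, $n_s=p$ for each $s\in\bigcup_{i\ne j}S_{ij}$, and $S=\bigcup_{i=1}^mS_i\cup(S\setminus R)$ where $R$ is the set of regular elements of $S$. Fix $\alpha_i\in\Omega_i$ ($1\le i\le m$), $t_1\in\mathbf{O}_\theta(S_1)\setminus\{1_{\Omega_1}\}$, and for $i\ge2$ let $t_i$ be the unique element of $\mathbf{O}_\theta(S_i)$ with $r(\alpha_1t_1,\alpha_it_i)=r(\alpha_1,\alpha_i)$. For each $i$ let $\{\alpha_{ik}\mid k=1,\dots,p\}\subseteq\Omega_i$ be a complete set of representatives of the equivalence relation $\bigcup_{t\in\mathbf{O}_\theta(S_i)}t$ on $\Omega_i$. Then for each $s\in S_{ij}$ with $i\ne j$ and all $k,l\in\{1,\dots,p\}$ there exists a unique $h(s)_{kl}\in\mathbb{Z}_p$ such that $r(\alpha_{ik},\alpha_{jl}t_j^{h(s)_{kl}})=s$. Moreover, if $s_1\in S_{ij}$ and $a\in\mathbb{Z}_p$ satisfy $s_1=st_j^a$, then $h(s_1)_{kl}=h(s)_{kl}+a$ for all $k,l\in\{1,\dots,p\}$.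
   Context: A coherent configuration is a pair $(\Omega,S)$ of a finite set $\Omega$ and a partition $S$ of $\Omega\times\Omega$ such that $1_\Omega$ is a union of elements of $S$, $s^\ast:=\{(\beta,\alpha)\mid(\alpha,\beta)\in s\}\in S$ for $s\in S$, and $\sigma_s\sigma_t=\sum_{u\in S}c_{st}^u\sigma_u$ with nonnegative integers $c_{st}^u$, where $\sigma_u$ is the adjacency matrix of $u$. Fibers are the sets $\Delta$ with $1_\Delta\in S$; they partition $\Omega$. $S_{ij}:=\{s\in S\mid s\subseteq\Omega_i\times\Omega_j\}$, $S_i:=S_{ii}$. For $s\in S_{ij}$, $n_s:=|\{\beta\mid(\alpha,\beta)\in s\}|$ for any $\alpha\in\Omega_i$. $\mathbf{O}_\theta(S_i):=\{t\in S_i\mid n_t=1\}$, a cyclic group of order $p$ under relational composition; for $u\in\mathbf{O}_\theta(S_j)$ and $\beta\in\Omega_j$, $\beta u$ is the unique $\gamma$ with $(\beta,\gamma)\in u$, $t_j^a$ is the $a$-fold composition, and for $s\in S_{ij}$, $st_j^a$ denotes the (unique) element of the complex product. $r(\alpha,\beta)$ is the unique element of $S$ containing $(\alpha,\beta)$. The complex product of $T,U\subseteq S$ is $TU:=\{s\mid c_{tu}^s>0$ for some $t\in T,u\in U\}$. An element $s$ is regular if $ss^\ast s=\{s\}$. $C_p\wr C_p$ is the association scheme on $\mathbb{Z}_p\times\mathbb{Z}_p$ with relations $\{((x,y),(x+a,y))\}$ ($a\in\mathbb{Z}_p$) and $\{((x_1,y),(x_2,y+b))\}$ ($b\ne0$).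 -}

module Defs where

open import Data.Nat using (ℕ; zero; suc; _+_; _∸_; _%_)
open import Data.Fin using (Fin; toℕ) renaming (zero to fzero; suc to fsuc)
open import Data.Fin.Properties using (_≟_)
open import Data.Bool using (Bool; true; false; if_then_else_; _∧_)
open import Data.Product using (Σ; _×_; _,_; ∃; ∃-syntax)
open import Data.Sum using (_⊎_; inj₁; inj₂)
open import Relation.Nullary using (¬_)
open import Relation.Nullary.Decidable using (⌊_⌋)
open import Relation.Binary.PropositionalEquality using (_≡_; _≢_)

count : ∀ {n} → (Fin n → Bool) → ℕ
count {zero}  f = 0
count {suc n} f = (if f fzero then 1 else 0) + count (λ x → f (fsuc x))

-- arithmetic modulo p (used only for p prime, so p ≥ 2)
addMod : ℕ → ℕ → ℕ → ℕ
addMod zero    a b = a + b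
addMod (suc q) a b = (a + b) % suc q

-- b - a modulo p, for a < p
subMod : ℕ → ℕ → ℕ → ℕ
subMod p b a = addMod p b (p ∸ a)

-- A configuration on Ω = Fin N is given by a colouring r : Ω × Ω → Fin d;
-- the relations (elements of S) are the colour classes r⁻¹(c).
-- r α β is the element of S containing (α, β), i.e. r(α,β) in the paper.

record IsCoherentConfiguration (N d : ℕ) (r : Fin N → Fin N → Fin d) : Set where
  field
    -- S is a partition: every colour class is nonempty
    nonempty : ∀ (s : Fin d) → ∃[ α ] ∃[ β ] (r α β ≡ s)
    -- 1_Ω is a union of elements of S
    diagonal : ∀ α β γ → r α α ≡ r β γ → β ≡ γ
    -- s* ∈ S for s ∈ S
    transpose : ∀ α β γ δ → r α β ≡ r γ δ → r β α ≡ r δ γ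
    -- σ_s σ_t = Σ_u c_{st}^u σ_u : the number of γ with r(α,γ) = s, r(γ,β) = t
    -- depends only on r(α,β)
    coherent : ∀ α β γ δ → r α β ≡ r γ δ → ∀ (s t : Fin d) →
      count (λ x → ⌊ r α x ≟ s ⌋ ∧ ⌊ r x β ≟ t ⌋)
        ≡ count (λ x → ⌊ r γ x ≟ s ⌋ ∧ ⌊ r x δ ≟ t ⌋)

-- A labelling of the fibers by Fin m: fib α is the index of the fiber
-- containing α; fibers are the classes of α ~ β ⇔ r(α,α) = r(β,β)
-- (the sets Δ with 1_Δ ∈ S).
record IsFiberLabelling (N d m : ℕ) (r : Fin N → Fin N → Fin d)
                        (fib : Fin N → Fin m) : Set where
  field
    sameFiber→ : ∀ α β → fib α ≡ fib β → r α α ≡ r β β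
    sameFiber← : ∀ α β → r α α ≡ r β β → fib α ≡ fib β
    fiberNonempty : ∀ (i : Fin m) → ∃[ α ] (fib α ≡ i)

module _ {N d m : ℕ} (r : Fin N → Fin N → Fin d) (fib : Fin N → Fin m) where

  InS : Fin m → Fin m → Fin d → Set
  InS i j s = ∃[ α ] ∃[ β ] (r α β ≡ s × fib α ≡ i × fib β ≡ j)

  -- n_s for s ∈ S containing (α, β): number of γ with r(α,γ) = s
  valency : Fin N → Fin N → ℕ
  valency α β = count (λ γ → ⌊ r α γ ≟ r α β ⌋)

  IsThinIn : Fin m → Fin d → Set
  IsThinIn i t = (∀ α β → r α β ≡ t → fib α ≡ i × fib β ≡ i × valency α β ≡ 1)

  -- the element r(α,β) is regular:  s s* s = {s}, i.e. every u in the
  -- complex product s s* s equals s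
  IsRegular : Fin d → Set
  IsRegular s = ∀ α β γ δ → r α β ≡ s → r γ β ≡ s → r γ δ ≡ s → r α δ ≡ s

  -- Pow t a β γ : (β, γ) ∈ t^a, i.e. γ = β t^a  (t^0 = identity)
  data Pow (t : Fin d) : ℕ → Fin N → Fin N → Set where
    pow-zero : ∀ β → Pow t 0 β β
    pow-suc  : ∀ {a β γ δ} → r β γ ≡ t → Pow t a γ δ → Pow t (suc a) β δ

  ThinEquiv : Fin m → Fin N → Fin N → Set
  ThinEquiv i β γ = IsThinIn i (r β γ)

-- The colouring of C_p ≀ C_p on Z_p × Z_p:
-- ((x,y),(x+a,y)) has colour inj₁ a, ((x₁,y),(x₂,y+b)) with b ≠ 0 has colour inj₂ b.
wrColour : (p : ℕ) → Fin p × Fin p → Fin p × Fin p → ℕ ⊎ ℕ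
wrColour p (x₁ , y₁) (x₂ , y₂) =
  if ⌊ y₁ ≟ y₂ ⌋ then inj₁ (subMod p (toℕ x₂) (toℕ x₁))
                  else inj₂ (subMod p (toℕ y₂) (toℕ y₁))

IsoToWreath : {N d m : ℕ} (r : Fin N → Fin N → Fin d) (fib : Fin N → Fin m)
              (p : ℕ) (i : Fin m) → Set
IsoToWreath {N} r fib p i =
  Σ (Fin p × Fin p → Fin N) λ g →
    (∀ u → fib (g u) ≡ i) ×
    (∀ u v → g u ≡ g v → u ≡ v) ×
    (∀ α → fib α ≡ i → ∃[ u ] (g u ≡ α)) ×
    (∀ u v w z → r (g u) (g v) ≡ r (g w) (g z) → wrColour p u v ≡ wrColour p w z) ×
    (∀ u v w z → wrColour p u v ≡ wrColour p w z → r (g u) (g v) ≡ r (g w) (g z))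

HCond : {N d m p : ℕ} (r : Fin N → Fin N → Fin d) (fib : Fin N → Fin m)
        (t : Fin m → Fin d) (rep : Fin m → Fin p → Fin N)
        (i j : Fin m) (s : Fin d) (k l : Fin p) (h : Fin p) → Set
HCond r fib t rep i j s k l h =
  ∃[ β ] (Pow r fib (t j) (toℕ h) (rep j l) β × r (rep i k) β ≡ s)

-- The isomorphisms with C_p ≀ C_p give each fibre coordinates (x, y) ∈ Z_p × Z_p, in which a thin relation
-- t_j is a translation x ↦ x + c_j inside the rows, and c_j ≢ 0 by the choice of the t_i. Take α outside
-- fibre j and s ∈ S_ij. If α saw two points of one row in colour s, then s would be invariant under a nonzero
-- row translation, hence (p being prime) a union of whole rows, and n_s = p would make s regular. So the p
-- s-neighbours of α lie in distinct rows, i.e. exactly one in each of the p rows, and h(s)_kl is the number of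
-- c_j-steps from α_jl to the s-neighbour of α_ik in its row. Following t_j^a adds a to that number.
module Submission where

open import Defs
open import Data.Nat using (ℕ; zero; suc; _+_; _*_; _∸_; _%_; _/_; _≤_; _<_; s≤s; NonZero; NonTrivial; nonTrivial⇒nonZero; nonTrivial⇒n>1)
open import Data.Nat.Properties using (+-assoc; +-comm; +-identityʳ; +-cancelˡ-≡; *-distribʳ-+; m+[n∸m]≡n; m∸n≤m; <⇒≤; ≤-total; ≤-<-trans; <-irrefl; 1+n≰n)
open import Data.Nat.DivMod using (_mod_; m≡m%n+[m/n]*n; m%n<n; m%n%n≡m%n; m<n⇒m%n≡m; [m+n]%n≡m%n; %-distribˡ-+; %-distribˡ-*; %-remove-+ʳ)
open import Data.Nat.Divisibility using (_∣_; divides; n∣m*n; _∣0; ∣m+n∣m⇒∣n; >⇒∤)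
open import Data.Nat.Primality using (Prime; euclidsLemma; prime⇒nonZero; prime⇒nonTrivial)
open import Data.Fin using (Fin; toℕ; zero; suc)
open import Data.Fin.Properties using (_≟_; any?; injective⇒≤; punchOut-injective; suc-injective; toℕ-fromℕ<; toℕ<n; toℕ-injective)
open import Data.Bool using (Bool; true; false; T; _∧_)
open import Data.Bool.Properties using (T-∧)
open import Data.Sum using (inj₁; inj₂)
open import Data.Sum.Properties using (inj₁-injective)
open import Data.Product using (Σ; _×_; _,_; ∃; ∃-syntax; proj₁; proj₂)
open import Function using (_∘_; flip)
open import Function.Bundles using (Equivalence)
open import Relation.Nullary using (¬_; yes; no; contradiction)
open import Relation.Nullary.Decidable using (⌊_⌋; toWitness; fromWitness)
open import Relation.Binary.PropositionalEquality
open ≡-Reasoning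

index : ∀ {n} (f : Fin n → Bool) x → T (f x) → Fin (count f)
index f zero fx with f zero
... | true = zero
index f (suc x) fx with f zero
... | true  = suc (index (f ∘ suc) x fx)
... | false = index (f ∘ suc) x fx

index-injective : ∀ {n} (f : Fin n → Bool) {x y} (fx : T (f x)) (fy : T (f y)) →
                  index f x fx ≡ index f y fy → x ≡ y
index-injective f {zero} {zero} fx fy eq = refl
index-injective f {zero} {suc y} fx fy eq with f zero
index-injective f {zero} {suc y} fx fy () | true
index-injective f {suc x} {zero} fx fy eq with f zero
index-injective f {suc x} {zero} fx fy () | true
index-injective f {suc x} {suc y} fx fy eq with f zero
... | true  = cong suc (index-injective (f ∘ suc) fx fy (suc-injective eq))
... | false = cong suc (index-injective (f ∘ suc) fx fy eq)

enumerate : ∀ {n} (f : Fin n → Bool) → Fin (count f) → Fin n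
enumerate {suc n} f i with f zero
enumerate {suc n} f zero    | true  = zero
enumerate {suc n} f (suc i) | true  = suc (enumerate (f ∘ suc) i)
enumerate {suc n} f i       | false = suc (enumerate (f ∘ suc) i)

enumerate-sound : ∀ {n} (f : Fin n → Bool) i → T (f (enumerate f i))
enumerate-sound {suc n} f i with f zero in eq
enumerate-sound {suc n} f zero    | true  rewrite eq = _
enumerate-sound {suc n} f (suc i) | true  = enumerate-sound (f ∘ suc) i
enumerate-sound {suc n} f i       | false = enumerate-sound (f ∘ suc) i

enumerate-injective : ∀ {n} (f : Fin n → Bool) {i j} → enumerate f i ≡ enumerate f j → i ≡ j
enumerate-injective {suc n} f {i} {j} eq with f zero
enumerate-injective {suc n} f {zero}  {zero}  eq | true = refl
enumerate-injective {suc n} f {suc i} {suc j} eq | true =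
  cong suc (enumerate-injective (f ∘ suc) (suc-injective eq))
enumerate-injective {suc n} f {i}     {j}     eq | false =
  enumerate-injective (f ∘ suc) (suc-injective eq)

count-transfer : ∀ {n} (f g : Fin n → Bool) → count f ≡ count g →
                 ∀ x → T (f x) → ∃ λ y → T (g y)
count-transfer f g eq x fx =
  let y = enumerate g (subst Fin eq (index f x fx)) in y , enumerate-sound g _

count≡1⇒unique : ∀ {n} (f : Fin n → Bool) → count f ≡ 1 →
                 ∀ {x y} → T (f x) → T (f y) → x ≡ y
count≡1⇒unique f eq fx fy = index-injective f fx fy (single eq (index f _ fx) (index f _ fy))
  where
  single : ∀ {k} → k ≡ 1 → (i j : Fin k) → i ≡ j
  single refl zero zero = refl

≤-count : ∀ {m n} (f : Fin n → Bool) (e : Fin m → Fin n) →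
          (∀ {i j} → e i ≡ e j → i ≡ j) → (∀ i → T (f (e i))) → m ≤ count f
≤-count f e e-inj fe = injective⇒≤ λ eq → e-inj (index-injective f (fe _) (fe _) eq)

count-< : ∀ {m n} (f : Fin n → Bool) (φ : ∀ x → T (f x) → Fin m) →
          (∀ {x y} fx fy → φ x fx ≡ φ y fy → x ≡ y) →
          (z : Fin m) → (∀ x fx → φ x fx ≢ z) → count f < m
count-< {suc m} f φ φ-inj z φ≢z = s≤s (injective⇒≤ λ eq →
  enumerate-injective f (φ-inj _ _ (punchOut-injective (z≢φ _) (z≢φ _) eq)))
  where
  z≢φ : ∀ i → z ≢ φ (enumerate f i) (enumerate-sound f i)
  z≢φ i = φ≢z _ _ ∘ sym

injective⇒surjective : ∀ {n} (f : Fin n → Fin n) → (∀ {i j} → f i ≡ f j → i ≡ j) →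
                       ∀ y → ∃ λ x → f x ≡ y
injective⇒surjective {suc n} f f-inj y with any? (λ x → f x ≟ y)
... | yes hit  = hit
... | no miss = contradiction (injective⇒≤ λ eq → f-inj (punchOut-injective (y≢f _) (y≢f _) eq)) 1+n≰n
  where
  y≢f : ∀ x → y ≢ f x
  y≢f x = miss ∘ (x ,_) ∘ sym

addMod≡% : ∀ p .{{_ : NonZero p}} m n → addMod p m n ≡ (m + n) % p
addMod≡% (suc p) m n = refl

[m+n]%d≡m%d⇒d∣n : ∀ m n d .{{_ : NonZero d}} → (m + n) % d ≡ m % d → d ∣ n
[m+n]%d≡m%d⇒d∣n m n d eq = ∣m+n∣m⇒∣n (divides ((m + n) / d) quotients) (n∣m*n (m / d))
  where
  quotients : m / d * d + n ≡ (m + n) / d * d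
  quotients = +-cancelˡ-≡ (m % d) _ _ (begin
    m % d + (m / d * d + n)   ≡⟨ +-assoc (m % d) _ n ⟨
    m % d + m / d * d + n     ≡⟨ cong (_+ n) (m≡m%n+[m/n]*n m d) ⟨
    m + n                     ≡⟨ m≡m%n+[m/n]*n (m + n) d ⟩
    (m + n) % d + (m + n) / d * d ≡⟨ cong (_+ (m + n) / d * d) eq ⟩
    m % d + (m + n) / d * d   ∎)

∣∧<⇒≡0 : ∀ {d k} → d ∣ k → k < d → k ≡ 0
∣∧<⇒≡0 {k = zero}  _   _   = refl
∣∧<⇒≡0 {k = suc k} d∣k k<d = contradiction d∣k (>⇒∤ k<d)

module Translation (p : ℕ) .{{_ : NonZero p}} where

  infixl 6 _⊕_
  _⊕_ : Fin p → ℕ → Fin p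
  x ⊕ n = (toℕ x + n) mod p

  Δ : Fin p → Fin p → ℕ
  Δ x y = subMod p (toℕ y) (toℕ x)

  toℕ-mod : ∀ n → toℕ (n mod p) ≡ n % p
  toℕ-mod n = toℕ-fromℕ< (m%n<n n p)

  toℕ-⊕ : ∀ x n → toℕ (x ⊕ n) ≡ (toℕ x + n) % p
  toℕ-⊕ x n = toℕ-mod (toℕ x + n)

  toℕ%p : ∀ (x : Fin p) → toℕ x % p ≡ toℕ x
  toℕ%p x = m<n⇒m%n≡m (toℕ<n x)

  %-absorbʳ : ∀ m n → (m + n % p) % p ≡ (m + n) % p
  %-absorbʳ m n = begin
    (m + n % p) % p           ≡⟨ %-distribˡ-+ m (n % p) p ⟩
    (m % p + n % p % p) % p   ≡⟨ cong (λ k → (m % p + k) % p) (m%n%n≡m%n n p) ⟩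
    (m % p + n % p) % p       ≡⟨ %-distribˡ-+ m n p ⟨
    (m + n) % p               ∎

  %-absorbˡ : ∀ m n → (m % p + n) % p ≡ (m + n) % p
  %-absorbˡ m n = begin
    (m % p + n) % p ≡⟨ cong (_% p) (+-comm (m % p) n) ⟩
    (n + m % p) % p ≡⟨ %-absorbʳ n m ⟩
    (n + m) % p     ≡⟨ cong (_% p) (+-comm n m) ⟩
    (m + n) % p     ∎

  ⊕-cong : ∀ x {m n} → m % p ≡ n % p → x ⊕ m ≡ x ⊕ n
  ⊕-cong x {m} {n} eq = toℕ-injective (begin
    toℕ (x ⊕ m)         ≡⟨ toℕ-⊕ x m ⟩
    (toℕ x + m) % p     ≡⟨ %-absorbʳ (toℕ x) m ⟨
    (toℕ x + m % p) % p ≡⟨ cong (λ k → (toℕ x + k) % p) eq ⟩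
    (toℕ x + n % p) % p ≡⟨ %-absorbʳ (toℕ x) n ⟩
    (toℕ x + n) % p     ≡⟨ toℕ-⊕ x n ⟨
    toℕ (x ⊕ n)         ∎)

  ⊕-assoc : ∀ x m n → x ⊕ m ⊕ n ≡ x ⊕ (m + n)
  ⊕-assoc x m n = toℕ-injective (begin
    toℕ (x ⊕ m ⊕ n)               ≡⟨ toℕ-⊕ (x ⊕ m) n ⟩
    (toℕ (x ⊕ m) + n) % p         ≡⟨ cong (λ k → (k + n) % p) (toℕ-⊕ x m) ⟩
    ((toℕ x + m) % p + n) % p     ≡⟨ %-absorbˡ (toℕ x + m) n ⟩
    (toℕ x + m + n) % p           ≡⟨ cong (_% p) (+-assoc (toℕ x) m n) ⟩
    (toℕ x + (m + n)) % p         ≡⟨ toℕ-⊕ x (m + n) ⟨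
    toℕ (x ⊕ (m + n))             ∎)

  ⊕-fixed⇒∣ : ∀ x n → x ⊕ n ≡ x → p ∣ n
  ⊕-fixed⇒∣ x n eq = [m+n]%d≡m%d⇒d∣n (toℕ x) n p
    (trans (sym (toℕ-⊕ x n)) (trans (cong toℕ eq) (sym (toℕ%p x))))

  ∣⇒⊕-fixed : ∀ x {n} → p ∣ n → x ⊕ n ≡ x
  ∣⇒⊕-fixed x {n} p∣n =
    toℕ-injective (trans (toℕ-⊕ x n) (trans (%-remove-+ʳ (toℕ x) p∣n) (toℕ%p x)))

  ⊕-identityʳ : ∀ x → x ⊕ 0 ≡ x
  ⊕-identityʳ x = ∣⇒⊕-fixed x (p ∣0)

  Δ≡ : ∀ x y → Δ x y ≡ (toℕ y + (p ∸ toℕ x)) % p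
  Δ≡ x y = addMod≡% p (toℕ y) (p ∸ toℕ x)

  x+[p∸x]≡p : ∀ (x : Fin p) → toℕ x + (p ∸ toℕ x) ≡ p
  x+[p∸x]≡p x = m+[n∸m]≡n (<⇒≤ (toℕ<n x))

  ⊕-Δ : ∀ x y → x ⊕ Δ x y ≡ y
  ⊕-Δ x y = toℕ-injective (begin
    toℕ (x ⊕ Δ x y)                          ≡⟨ toℕ-⊕ x (Δ x y) ⟩
    (toℕ x + Δ x y) % p                      ≡⟨ cong (λ k → (toℕ x + k) % p) (Δ≡ x y) ⟩
    (toℕ x + (toℕ y + (p ∸ toℕ x)) % p) % p  ≡⟨ %-absorbʳ (toℕ x) _ ⟩
    (toℕ x + (toℕ y + (p ∸ toℕ x))) % p      ≡⟨ cong (_% p) (x+[y+z]≡y+[x+z] (toℕ x) (toℕ y) _) ⟩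
    (toℕ y + (toℕ x + (p ∸ toℕ x))) % p      ≡⟨ cong (λ k → (toℕ y + k) % p) (x+[p∸x]≡p x) ⟩
    (toℕ y + p) % p                          ≡⟨ [m+n]%n≡m%n (toℕ y) p ⟩
    toℕ y % p                                ≡⟨ toℕ%p y ⟩
    toℕ y                                    ∎)
    where
    x+[y+z]≡y+[x+z] : ∀ a b c → a + (b + c) ≡ b + (a + c)
    x+[y+z]≡y+[x+z] a b c = trans (sym (+-assoc a b c)) (trans (cong (_+ c) (+-comm a b)) (+-assoc b a c))

  Δ-⊕ : ∀ x n → Δ x (x ⊕ n) ≡ n % p
  Δ-⊕ x n = begin
    Δ x (x ⊕ n)                              ≡⟨ Δ≡ x (x ⊕ n) ⟩
    (toℕ (x ⊕ n) + (p ∸ toℕ x)) % p          ≡⟨ cong (λ k → (k + (p ∸ toℕ x)) % p) (toℕ-⊕ x n) ⟩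
    ((toℕ x + n) % p + (p ∸ toℕ x)) % p      ≡⟨ %-absorbˡ (toℕ x + n) _ ⟩
    (toℕ x + n + (p ∸ toℕ x)) % p            ≡⟨ cong (_% p) (+-assoc (toℕ x) n _) ⟩
    (toℕ x + (n + (p ∸ toℕ x))) % p          ≡⟨ cong (λ k → (toℕ x + k) % p) (+-comm n _) ⟩
    (toℕ x + ((p ∸ toℕ x) + n)) % p          ≡⟨ cong (_% p) (+-assoc (toℕ x) _ n) ⟨
    (toℕ x + (p ∸ toℕ x) + n) % p            ≡⟨ cong (λ k → (k + n) % p) (x+[p∸x]≡p x) ⟩
    (p + n) % p                              ≡⟨ cong (_% p) (+-comm p n) ⟩
    (n + p) % p                              ≡⟨ [m+n]%n≡m%n n p ⟩
    n % p                                    ∎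

  Δ-injective : ∀ x {y z} → Δ x y ≡ Δ x z → y ≡ z
  Δ-injective x {y} {z} eq = trans (sym (⊕-Δ x y)) (trans (cong (x ⊕_) eq) (⊕-Δ x z))

  ∣Δ⇒≡ : ∀ x y → p ∣ Δ x y → x ≡ y
  ∣Δ⇒≡ x y p∣Δ = trans (sym (∣⇒⊕-fixed x p∣Δ)) (⊕-Δ x y)

  ⊕-%-* : ∀ x m c → x ⊕ m % p * c ≡ x ⊕ m * c
  ⊕-%-* x m c = ⊕-cong x (begin
    (m % p * c) % p           ≡⟨ %-distribˡ-* (m % p) c p ⟩
    (m % p % p * (c % p)) % p ≡⟨ cong (λ k → (k * (c % p)) % p) (m%n%n≡m%n m p) ⟩
    (m % p * (c % p)) % p     ≡⟨ %-distribˡ-* m c p ⟨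
    (m * c) % p               ∎)

  module _ (p-prime : Prime p) {c} (p∤c : ¬ p ∣ c) where

    private
      orbit-injective-≤ : ∀ x {m n} → m ≤ n → n < p → x ⊕ m * c ≡ x ⊕ n * c → m ≡ n
      orbit-injective-≤ x {m} {n} m≤n n<p eq = begin
        m           ≡⟨ +-identityʳ m ⟨
        m + 0       ≡⟨ cong (m +_) k≡0 ⟨
        m + (n ∸ m) ≡⟨ m+[n∸m]≡n m≤n ⟩
        n           ∎
        where
        k = n ∸ m
        moves : x ⊕ m * c ⊕ k * c ≡ x ⊕ m * c
        moves = begin
          x ⊕ m * c ⊕ k * c   ≡⟨ ⊕-assoc x (m * c) (k * c) ⟩
          x ⊕ (m * c + k * c) ≡⟨ cong (x ⊕_) (*-distribʳ-+ c m k) ⟨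
          x ⊕ (m + k) * c     ≡⟨ cong (λ l → x ⊕ l * c) (m+[n∸m]≡n m≤n) ⟩
          x ⊕ n * c           ≡⟨ eq ⟨
          x ⊕ m * c           ∎
        k≡0 : k ≡ 0
        k≡0 with euclidsLemma k c p-prime (⊕-fixed⇒∣ (x ⊕ m * c) (k * c) moves)
        ... | inj₁ p∣k = ∣∧<⇒≡0 p∣k (≤-<-trans (m∸n≤m n m) n<p)
        ... | inj₂ p∣c = contradiction p∣c p∤c

    orbit-injective : ∀ x {h h′ : Fin p} → x ⊕ toℕ h * c ≡ x ⊕ toℕ h′ * c → h ≡ h′
    orbit-injective x {h} {h′} eq with ≤-total (toℕ h) (toℕ h′)
    ... | inj₁ h≤h′ = toℕ-injective (orbit-injective-≤ x h≤h′ (toℕ<n h′) eq)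
    ... | inj₂ h′≤h = toℕ-injective (sym (orbit-injective-≤ x h′≤h (toℕ<n h) (sym eq)))

    orbit-surjective : ∀ x y → ∃ λ (h : Fin p) → x ⊕ toℕ h * c ≡ y
    orbit-surjective x = injective⇒surjective (λ h → x ⊕ toℕ h * c) (orbit-injective x)

thin-functional : ∀ {N d m} {r : Fin N → Fin N → Fin d} {fib : Fin N → Fin m} {i t} →
                  IsThinIn r fib i t → ∀ {y w w′} → r y w ≡ t → r y w′ ≡ t → w ≡ w′
thin-functional {r = r} thin {y} {w} {w′} yw≡t yw′≡t =
  count≡1⇒unique (λ γ → ⌊ r y γ ≟ r y w ⌋) (proj₂ (proj₂ (thin y w yw≡t)))
    (fromWitness refl) (fromWitness (trans yw′≡t (sym yw≡t)))

module Coherent {N d m : ℕ} {r : Fin N → Fin N → Fin d} (cc : IsCoherentConfiguration N d r)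
                {fib : Fin N → Fin m} (fl : IsFiberLabelling N d m r fib) where

  open IsCoherentConfiguration cc
  open IsFiberLabelling fl

  private
    through : (a b w x y : Fin N) → Fin N → Bool
    through a b w x y z = ⌊ r x z ≟ r a w ⌋ ∧ ⌊ r z y ≟ r w b ⌋

  intermediate : ∀ {a b a′ b′} → r a b ≡ r a′ b′ →
                 ∀ w → ∃ λ w′ → r a′ w′ ≡ r a w × r w′ b′ ≡ r w b
  intermediate {a} {b} {a′} {b′} eq w
    with w′ , hit ← count-transfer (through a b w a b) (through a b w a′ b′)
                      (coherent a b a′ b′ eq (r a w) (r w b)) w
                      (Equivalence.from (T-∧ {⌊ r a w ≟ r a w ⌋}) (fromWitness refl , fromWitness refl))
    with hit₁ , hit₂ ← Equivalence.to (T-∧ {⌊ r a′ w′ ≟ r a w ⌋}) hit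
    = w′ , toWitness hit₁ , toWitness hit₂

  colour-fibres : ∀ {a b a′ b′} → r a b ≡ r a′ b′ → fib a ≡ fib a′ × fib b ≡ fib b′
  colour-fibres {a} {b} {a′} {b′} eq = source , target
    where
    source : fib a ≡ fib a′
    source with w′ , e , _ ← intermediate eq a with refl ← diagonal a a′ w′ (sym e) =
      sameFiber← a a′ (sym e)
    target : fib b ≡ fib b′
    target with w′ , _ , e ← intermediate eq b with refl ← diagonal b w′ b′ (sym e) =
      sameFiber← b w′ (sym e)

  neighbour-in-fibre : ∀ {i j s α} → InS r fib i j s → fib α ≡ i → ∃ λ w → r α w ≡ s × fib w ≡ j
  neighbour-in-fibre {α = α} (α₀ , β₀ , α₀β₀≡s , α₀∈i , β₀∈j) α∈i =
    let w , αw≡α₀β₀ , _ = intermediate (sameFiber→ α₀ α (trans α₀∈i (sym α∈i))) β₀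
        αw≡s = trans αw≡α₀β₀ α₀β₀≡s
    in w , αw≡s , trans (sym (proj₂ (colour-fibres (trans α₀β₀≡s (sym αw≡s))))) β₀∈j

  compose-functional : ∀ {x y z x′ y′ z′} → r x y ≡ r x′ y′ → r y z ≡ r y′ z′ →
                       (∀ w → r y′ w ≡ r y′ z′ → w ≡ z′) → r x z ≡ r x′ z′
  compose-functional {x} {y} {z} {x′} {y′} {z′} xy≡ yz≡ functional
    with w′ , x′w′≡xz , w′y′≡zy ← intermediate xy≡ z
    with refl ← functional w′ (trans (transpose w′ y′ z y w′y′≡zy) yz≡) = sym x′w′≡xz

  pow-respects-colour : ∀ {j t} → IsThinIn r fib j t → ∀ {n x y z x′ y′ z′} → r x y ≡ r x′ y′ →
                        Pow r fib t n y z → Pow r fib t n y′ z′ → r x z ≡ r x′ z′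
  pow-respects-colour thin eq (pow-zero _) (pow-zero _) = eq
  pow-respects-colour thin eq (pow-suc yγ≡t rest) (pow-suc y′γ′≡t rest′) =
    pow-respects-colour thin
      (compose-functional eq (trans yγ≡t (sym y′γ′≡t)) (λ _ e → thin-functional thin (trans e y′γ′≡t) y′γ′≡t))
      rest rest′

module WreathRows (p : ℕ) .{{_ : NonZero p}} where

  open Translation p

  wrColour-row : ∀ x x′ y → wrColour p (x , y) (x′ , y) ≡ inj₁ (Δ x x′)
  wrColour-row x x′ y with y ≟ y
  ... | yes _   = refl
  ... | no y≢y = contradiction refl y≢y

  wrColour-across : ∀ {y y′} → y ≢ y′ → ∀ x x₁ x₂ → wrColour p (x , y) (x₁ , y′) ≡ wrColour p (x , y) (x₂ , y′)
  wrColour-across {y} {y′} y≢y′ x x₁ x₂ with y ≟ y′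
  ... | yes y≡y′ = contradiction y≡y′ y≢y′
  ... | no _     = refl

  wrColour≡inj₁ : ∀ {x y x′ y′ n} → wrColour p (x , y) (x′ , y′) ≡ inj₁ n → y ≡ y′ × Δ x x′ ≡ n
  wrColour≡inj₁ {y = y} {y′ = y′} eq with y ≟ y′
  ... | yes refl = refl , inj₁-injective eq
  ... | no _ with () ← eq

module WreathFibre {N d m : ℕ} {r : Fin N → Fin N → Fin d} (cc : IsCoherentConfiguration N d r)
                   {fib : Fin N → Fin m} (fl : IsFiberLabelling N d m r fib)
                   {p : ℕ} (p-prime : Prime p) {j : Fin m} (iso : IsoToWreath r fib p j) where

  private instance
    p-nonTrivial : NonTrivial p
    p-nonTrivial = prime⇒nonTrivial p-prime
    p-nonZero : NonZero p
    p-nonZero = nonTrivial⇒nonZero p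

  open IsCoherentConfiguration cc using (nonempty)
  open Coherent cc fl
  open Translation p
  open WreathRows p

  point : Fin p × Fin p → Fin N
  point = proj₁ iso

  point-fib : ∀ u → fib (point u) ≡ j
  point-fib = proj₁ (proj₂ iso)

  point-injective : ∀ {u v} → point u ≡ point v → u ≡ v
  point-injective = proj₁ (proj₂ (proj₂ iso)) _ _

  point-surjective : ∀ {w} → fib w ≡ j → ∃ λ u → point u ≡ w
  point-surjective = proj₁ (proj₂ (proj₂ (proj₂ iso))) _

  colour-reflects : ∀ {u v u′ v′} → r (point u) (point v) ≡ r (point u′) (point v′) →
                    wrColour p u v ≡ wrColour p u′ v′
  colour-reflects = proj₁ (proj₂ (proj₂ (proj₂ (proj₂ iso)))) _ _ _ _

  colour-preserves : ∀ {u v u′ v′} → wrColour p u v ≡ wrColour p u′ v′ →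
                     r (point u) (point v) ≡ r (point u′) (point v′)
  colour-preserves = proj₂ (proj₂ (proj₂ (proj₂ (proj₂ iso)))) _ _ _ _

  translation-colour : ∀ x y u v n →
    r (point (x , y)) (point (x ⊕ n , y)) ≡ r (point (u , v)) (point (u ⊕ n , v))
  translation-colour x y u v n = colour-preserves (begin
    wrColour p (x , y) (x ⊕ n , y)  ≡⟨ wrColour-row x (x ⊕ n) y ⟩
    inj₁ (Δ x (x ⊕ n))              ≡⟨ cong inj₁ (trans (Δ-⊕ x n) (sym (Δ-⊕ u n))) ⟩
    inj₁ (Δ u (u ⊕ n))              ≡⟨ wrColour-row u (u ⊕ n) v ⟨
    wrColour p (u , v) (u ⊕ n , v)  ∎)

  row-target-unique : ∀ {x x′ y w} → r (point (x , y)) w ≡ r (point (x , y)) (point (x′ , y)) →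
                      w ≡ point (x′ , y)
  row-target-unique {x} {x′} {y} {w} eq
    with (x₂ , y₂) , refl ← point-surjective (trans (proj₂ (colour-fibres eq)) (point-fib _))
    with refl , Δ≡ ← wrColour≡inj₁ {x = x} (trans (colour-reflects eq) (wrColour-row x x′ y))
    = cong (λ z → point (z , y)) (Δ-injective x Δ≡)

  thin-stays-in-row : ∀ {t} → IsThinIn r fib j t → ∀ {x y x′ y′} →
                      r (point (x , y)) (point (x′ , y′)) ≡ t → y ≡ y′
  thin-stays-in-row thin {x} {y} {x′} {y′} eq with y ≟ y′
  ... | yes y≡y′ = y≡y′
  ... | no y≢y′ = contradiction (⊕-fixed⇒∣ x′ 1 (cong proj₁ (point-injective moved))) (>⇒∤ (nonTrivial⇒n>1 p))
    where
    moved : point (x′ ⊕ 1 , y′) ≡ point (x′ , y′)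
    moved = thin-functional thin (trans (colour-preserves (wrColour-across y≢y′ x (x′ ⊕ 1) x′)) eq) eq

  thin-translation : ∀ {t} → IsThinIn r fib j t →
                     ∃ λ c → ∀ x y → r (point (x , y)) (point (x ⊕ c , y)) ≡ t
  thin-translation {t} thin
    with a , b , ab≡t ← nonempty t
    with a∈j , b∈j , _ ← thin a b ab≡t
    with (xa , ya) , refl ← point-surjective a∈j
    with (xb , yb) , refl ← point-surjective b∈j
    with refl ← thin-stays-in-row thin ab≡t
    = Δ xa xb , λ x y → begin
      r (point (x , y)) (point (x ⊕ Δ xa xb , y))      ≡⟨ translation-colour x y xa ya (Δ xa xb) ⟩
      r (point (xa , ya)) (point (xa ⊕ Δ xa xb , ya))  ≡⟨ cong (λ z → r (point (xa , ya)) (point (z , ya))) (⊕-Δ xa xb) ⟩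
      r (point (xa , ya)) (point (xb , ya))            ≡⟨ ab≡t ⟩
      t                                                ∎

  module ThinTranslation {t c} (thin : IsThinIn r fib j t)
                         (step : ∀ x y → r (point (x , y)) (point (x ⊕ c , y)) ≡ t) where

    pow-translate : ∀ n x y → Pow r fib t n (point (x , y)) (point (x ⊕ n * c , y))
    pow-translate zero x y =
      subst (λ z → Pow r fib t 0 (point (x , y)) (point (z , y))) (sym (⊕-identityʳ x)) (pow-zero _)
    pow-translate (suc n) x y = pow-suc (step x y)
      (subst (λ z → Pow r fib t n (point (x ⊕ c , y)) (point (z , y))) (⊕-assoc x c (n * c))
        (pow-translate n (x ⊕ c) y))

    translate-pow : ∀ {n} x y {z} → Pow r fib t n (point (x , y)) z → z ≡ point (x ⊕ n * c , y)
    translate-pow x y (pow-zero _) = cong (λ z → point (z , y)) (sym (⊕-identityʳ x))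
    translate-pow {suc n} x y (pow-suc e rest) with refl ← thin-functional thin e (step x y) =
      trans (translate-pow (x ⊕ c) y rest) (cong (λ z → point (z , y)) (⊕-assoc x c (n * c)))

    divisible⇒diagonal : p ∣ c → ∀ {w} → fib w ≡ j → r w w ≡ t
    divisible⇒diagonal p∣c w∈j with (x , y) , refl ← point-surjective w∈j =
      subst (λ z → r (point (x , y)) (point (z , y)) ≡ t) (∣⇒⊕-fixed x p∣c) (step x y)

  target-in-fibre : ∀ {a b a₀ u₀} → r a b ≡ r a₀ (point u₀) → fib b ≡ j
  target-in-fibre eq = trans (proj₂ (colour-fibres eq)) (point-fib _)

  Saturated : Fin d → Set
  Saturated s = ∀ {a x y} x′ → r a (point (x , y)) ≡ s → r a (point (x′ , y)) ≡ s

  repeated-colour⇒saturated : ∀ {a x x′ y} → x ≢ x′ →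
    r a (point (x , y)) ≡ r a (point (x′ , y)) → Saturated (r a (point (x , y)))
  repeated-colour⇒saturated {a} {x} {x′} {y} x≢x′ eq {a₁} {u} {v} u′ hit
    with h , refl ← orbit-surjective p-prime (x≢x′ ∘ ∣Δ⇒≡ x x′) u u′ = iterate (toℕ h) hit
    where
    s = r a (point (x , y))
    n = Δ x x′
    step : ∀ {u} → r a₁ (point (u , v)) ≡ s → r a₁ (point (u ⊕ n , v)) ≡ s
    step {u} hit = begin
      r a₁ (point (u ⊕ n , v)) ≡⟨ compose-functional (sym hit) (translation-colour x y u v n) (λ _ → row-target-unique) ⟨
      r a (point (x ⊕ n , y))  ≡⟨ cong (λ z → r a (point (z , y))) (⊕-Δ x x′) ⟩
      r a (point (x′ , y))     ≡⟨ eq ⟨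
      s                        ∎
    iterate : ∀ k {u} → r a₁ (point (u , v)) ≡ s → r a₁ (point (u ⊕ k * n , v)) ≡ s
    iterate zero    {u} hit = subst (λ z → r a₁ (point (z , v)) ≡ s) (sym (⊕-identityʳ u)) hit
    iterate (suc k) {u} hit = subst (λ z → r a₁ (point (z , v)) ≡ s) (⊕-assoc u n (k * n)) (iterate k (step hit))

  module _ (cross-valency : ∀ α β → fib α ≢ fib β → valency r fib α β ≡ p) where

    saturated⇒regular : ∀ {a₀ u₀} → fib a₀ ≢ j → Saturated (r a₀ (point u₀)) →
                        IsRegular r fib (r a₀ (point u₀))
    saturated⇒regular {a₀} {u₀} a₀∉j saturated a b c e ab≡s cb≡s ce≡s
      with (xb , yb) , refl ← point-surjective (target-in-fibre ab≡s)
      with (xe , ye) , refl ← point-surjective (target-in-fibre ce≡s)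
      with ye ≟ yb
    ... | yes refl = saturated xe ab≡s
    ... | no ye≢yb =
      contradiction (subst (suc p ≤_) (cross-valency c _ c∉j) (≤-count _ neighbour neighbour-injective hits)) 1+n≰n
      where
      c∉j : fib c ≢ fib (point (xe , ye))
      c∉j c∈j = a₀∉j (trans (sym (proj₁ (colour-fibres ce≡s))) (trans c∈j (point-fib _)))
      neighbour : Fin (suc p) → Fin N
      neighbour zero    = point (xe , ye)
      neighbour (suc x) = point (x , yb)
      neighbour-injective : ∀ {i k} → neighbour i ≡ neighbour k → i ≡ k
      neighbour-injective {zero}  {zero}  _  = refl
      neighbour-injective {zero}  {suc _} eq = contradiction (cong proj₂ (point-injective eq)) ye≢yb
      neighbour-injective {suc _} {zero}  eq = contradiction (cong proj₂ (point-injective (sym eq))) ye≢yb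
      neighbour-injective {suc _} {suc _} eq = cong suc (cong proj₁ (point-injective eq))
      hits : ∀ i → T ⌊ r c (neighbour i) ≟ r c (point (xe , ye)) ⌋
      hits zero    = fromWitness refl
      hits (suc x) = fromWitness (trans (saturated x cb≡s) (sym ce≡s))

    module _ (non-regular : ∀ α β → fib α ≢ fib β → ¬ IsRegular r fib (r α β)) where

      row-injective : ∀ {a x x′ y} → fib a ≢ j → r a (point (x , y)) ≡ r a (point (x′ , y)) → x ≡ x′
      row-injective {a} {x} {x′} a∉j eq with x ≟ x′
      ... | yes x≡x′ = x≡x′
      ... | no x≢x′ = contradiction (saturated⇒regular a∉j (repeated-colour⇒saturated x≢x′ eq))
                                    (non-regular a _ (a∉j ∘ flip trans (point-fib _)))

      same-colour⇒same-point : ∀ {a u v} → fib a ≢ j → r a (point u) ≡ r a (point v) → proj₂ u ≡ proj₂ v → u ≡ v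
      same-colour⇒same-point {u = _ , y} {v = _ , .y} a∉j eq refl = cong (_, y) (row-injective a∉j eq)

      row-hit : ∀ {a w} → fib a ≢ j → fib w ≡ j → ∀ y → ∃ λ x → r a (point (x , y)) ≡ r a w
      row-hit {a} {w} a∉j w∈j y with any? (λ x → r a (point (x , y)) ≟ r a w)
      ... | yes hit = hit
      ... | no miss = contradiction (count-< _ row row-determines y row≢y)
                                    (<-irrefl (cross-valency a w (a∉j ∘ flip trans w∈j)))
        where
        in-j : ∀ γ → T ⌊ r a γ ≟ r a w ⌋ → fib γ ≡ j
        in-j γ hit = trans (proj₂ (colour-fibres (toWitness hit))) w∈j
        coords : ∀ γ → T ⌊ r a γ ≟ r a w ⌋ → Fin p × Fin p
        coords γ hit = proj₁ (point-surjective (in-j γ hit))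
        point-coords : ∀ γ hit → point (coords γ hit) ≡ γ
        point-coords γ hit = proj₂ (point-surjective (in-j γ hit))
        row : ∀ γ → T ⌊ r a γ ≟ r a w ⌋ → Fin p
        row γ hit = proj₂ (coords γ hit)
        row-determines : ∀ {γ γ′} hit hit′ → row γ hit ≡ row γ′ hit′ → γ ≡ γ′
        row-determines {γ} {γ′} hit hit′ same-row = begin
          γ                     ≡⟨ point-coords γ hit ⟨
          point (coords γ hit)  ≡⟨ cong point (same-colour⇒same-point a∉j same-colour same-row) ⟩
          point (coords γ′ hit′) ≡⟨ point-coords γ′ hit′ ⟩
          γ′                    ∎
          where
          same-colour : r a (point (coords γ hit)) ≡ r a (point (coords γ′ hit′))
          same-colour = trans (cong (r a) (point-coords γ hit))
            (trans (toWitness hit) (sym (trans (cong (r a) (point-coords γ′ hit′)) (toWitness hit′))))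
        row≢y : ∀ γ hit → row γ hit ≢ y
        row≢y γ hit refl = miss (proj₁ (coords γ hit) , trans (cong (r a) (point-coords γ hit)) (toWitness hit))

      module Exponents {t c} (thin : IsThinIn r fib j t)
               (step : ∀ x y → r (point (x , y)) (point (x ⊕ c , y)) ≡ t) (p∤c : ¬ p ∣ c) where

        open ThinTranslation thin step

        exponent-exists : ∀ {a β₀ w} → fib a ≢ j → fib β₀ ≡ j → fib w ≡ j →
                          ∃ λ (h : Fin p) → ∃ λ β → Pow r fib t (toℕ h) β₀ β × r a β ≡ r a w
        exponent-exists a∉j β₀∈j w∈j
          with (x₀ , y₀) , refl ← point-surjective β₀∈j
          with x , hit ← row-hit a∉j w∈j y₀
          with h , refl ← orbit-surjective p-prime p∤c x₀ x
          = h , _ , pow-translate (toℕ h) x₀ y₀ , hit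

        exponent-unique : ∀ {a β₀ β β′ s} {h h′ : Fin p} → fib a ≢ j → fib β₀ ≡ j →
                          Pow r fib t (toℕ h) β₀ β → r a β ≡ s →
                          Pow r fib t (toℕ h′) β₀ β′ → r a β′ ≡ s → h ≡ h′
        exponent-unique a∉j β₀∈j pow hit pow′ hit′
          with (x₀ , y₀) , refl ← point-surjective β₀∈j
          with refl ← translate-pow x₀ y₀ pow
          with refl ← translate-pow x₀ y₀ pow′
          = orbit-injective p-prime p∤c x₀ (row-injective a∉j (trans hit (sym hit′)))

        exponent-shift : ∀ {a β₀ β β₁ x y z s s₁} {h h₁ e : Fin p} → fib a ≢ j → fib β₀ ≡ j →
                         r x y ≡ s → Pow r fib t (toℕ e) y z → r x z ≡ s₁ →
                         Pow r fib t (toℕ h) β₀ β → r a β ≡ s →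
                         Pow r fib t (toℕ h₁) β₀ β₁ → r a β₁ ≡ s₁ →
                         toℕ h₁ ≡ (toℕ h + toℕ e) % p
        exponent-shift {a} {s₁ = s₁} {h} {h₁} {e} a∉j β₀∈j xy≡s pow-e xz≡s₁ pow hit pow₁ hit₁
          with (x₀ , y₀) , refl ← point-surjective β₀∈j
          with refl ← translate-pow x₀ y₀ pow
          = trans (cong toℕ (exponent-unique a∉j β₀∈j pow₁ hit₁ pow-sum hit-sum)) (toℕ-mod _)
          where
          sum : Fin p
          sum = (toℕ h + toℕ e) mod p
          γ : Fin N
          γ = point (x₀ ⊕ toℕ h * c ⊕ toℕ e * c , y₀)
          hit-sum : r a γ ≡ s₁
          hit-sum = trans (sym (pow-respects-colour thin (trans xy≡s (sym hit)) pow-e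
                                  (pow-translate (toℕ e) (x₀ ⊕ toℕ h * c) y₀))) xz≡s₁
          same-target : x₀ ⊕ toℕ sum * c ≡ x₀ ⊕ toℕ h * c ⊕ toℕ e * c
          same-target = begin
            x₀ ⊕ toℕ sum * c                 ≡⟨ cong (λ k → x₀ ⊕ k * c) (toℕ-mod _) ⟩
            x₀ ⊕ (toℕ h + toℕ e) % p * c     ≡⟨ ⊕-%-* x₀ (toℕ h + toℕ e) c ⟩
            x₀ ⊕ (toℕ h + toℕ e) * c         ≡⟨ cong (x₀ ⊕_) (*-distribʳ-+ c (toℕ h) (toℕ e)) ⟩
            x₀ ⊕ (toℕ h * c + toℕ e * c)     ≡⟨ ⊕-assoc x₀ (toℕ h * c) (toℕ e * c) ⟨
            x₀ ⊕ toℕ h * c ⊕ toℕ e * c       ∎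
          pow-sum : Pow r fib t (toℕ sum) (point (x₀ , y₀)) γ
          pow-sum = subst (λ z → Pow r fib t (toℕ sum) (point (x₀ , y₀)) (point (z , y₀))) same-target
                      (pow-translate (toℕ sum) x₀ y₀)

module Exponent {p : ℕ} (p-prime : Prime p)
  {N d m : ℕ} {r : Fin N → Fin N → Fin d} (cc : IsCoherentConfiguration N d r)
  {fib : Fin N → Fin (suc m)} (fl : IsFiberLabelling N d (suc m) r fib)
  (iso : ∀ i → IsoToWreath r fib p i)
  (cross-valency : ∀ α β → fib α ≢ fib β → valency r fib α β ≡ p)
  (non-regular : ∀ α β → fib α ≢ fib β → ¬ IsRegular r fib (r α β))
  {t : Fin (suc m) → Fin d} (thin : ∀ i → IsThinIn r fib i (t i)) where

  private instance
    p-nonZero : NonZero p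
    p-nonZero = prime⇒nonZero p-prime

  open IsCoherentConfiguration cc using (transpose)
  open Coherent cc fl using (neighbour-in-fibre)
  open Translation p
  module Fibre (j : Fin (suc m)) = WreathFibre cc fl p-prime (iso j)
  open Fibre using (point)

  shift : Fin (suc m) → ℕ
  shift j = proj₁ (Fibre.thin-translation j (thin j))

  shift-step : ∀ j x y → r (point j (x , y)) (point j (x ⊕ shift j , y)) ≡ t j
  shift-step j = proj₂ (Fibre.thin-translation j (thin j))

  module _ (pt : Fin (suc m) → Fin N) (pt∈ : ∀ i → fib (pt i) ≡ i)
           (t₀≢1 : t zero ≢ r (pt zero) (pt zero))
           (compatible : ∀ i β γ → r (pt zero) β ≡ t zero → r (pt i) γ ≡ t i → r β γ ≡ r (pt zero) (pt i)) where

    private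
      diagonal : ∀ j → p ∣ shift j → r (pt j) (pt j) ≡ t j
      diagonal j p∣shift = Fibre.ThinTranslation.divisible⇒diagonal j (thin j) (shift-step j) p∣shift (pt∈ j)

    p∤shift₀ : ¬ p ∣ shift zero
    p∤shift₀ p∣shift = t₀≢1 (sym (diagonal zero p∣shift))

    -- For j ≠ 0 a trivial shift makes t_j the identity, and the compatibility of the t_i then gives pt_j
    -- the same colour towards pt_0 and towards pt_0 t_0, two distinct points of one row.
    p∤shift : ∀ j → ¬ p ∣ shift j
    p∤shift j p∣shift with j ≟ zero
    ... | yes refl = p∤shift₀ p∣shift
    ... | no j≢0 with (x₀ , y₀) , at-pt₀ ← Fibre.point-surjective zero (pt∈ zero) =
      p∤shift₀ (⊕-fixed⇒∣ x₀ (shift zero) (Fibre.row-injective zero cross-valency non-regular pt-j∉0 same-colour))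
      where
      pt-j∉0 : fib (pt j) ≢ zero
      pt-j∉0 = j≢0 ∘ trans (sym (pt∈ j))
      β = point zero (x₀ ⊕ shift zero , y₀)
      same-colour : r (pt j) β ≡ r (pt j) (point zero (x₀ , y₀))
      same-colour = begin
        r (pt j) β          ≡⟨ transpose β (pt j) (pt zero) (pt j) (compatible j β (pt j) pt₀-t₀-β (diagonal j p∣shift)) ⟩
        r (pt j) (pt zero)  ≡⟨ cong (r (pt j)) at-pt₀ ⟨
        r (pt j) (point zero (x₀ , y₀)) ∎
        where
        pt₀-t₀-β : r (pt zero) β ≡ t zero
        pt₀-t₀-β = subst (λ w → r w β ≡ t zero) at-pt₀ (shift-step zero x₀ y₀)

    module _ (rep : Fin (suc m) → Fin p → Fin N) (rep∈ : ∀ i k → fib (rep i k) ≡ i) where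

      private
        rep∉ : ∀ {i j} → i ≢ j → ∀ k → fib (rep i k) ≢ j
        rep∉ i≢j k = i≢j ∘ trans (sym (rep∈ _ k))

        module Exponents (j : Fin (suc m)) =
          Fibre.Exponents j cross-valency non-regular (thin j) (shift-step j) (p∤shift j)

      exponent-exists-unique : ∀ i j → i ≢ j → ∀ s → InS r fib i j s → ∀ k l →
        Σ (Fin p) λ h → HCond r fib t rep i j s k l h × (∀ h′ → HCond r fib t rep i j s k l h′ → h′ ≡ h)
      exponent-exists-unique i j i≢j s s∈ k l
        with w , αw≡s , w∈j ← neighbour-in-fibre s∈ (rep∈ i k)
        with h , β , pow , hit ← Exponents.exponent-exists j (rep∉ i≢j k) (rep∈ j l) w∈j
        = h , (β , pow , trans hit αw≡s) , λ { h′ (β′ , pow′ , hit′) →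
            Exponents.exponent-unique j (rep∉ i≢j k) (rep∈ j l) pow′ hit′ pow (trans hit αw≡s) }

      exponent-additive : ∀ i j → i ≢ j → ∀ s s₁ → InS r fib i j s → InS r fib i j s₁ → ∀ (a : Fin p) →
        (∃[ x ] ∃[ y ] ∃[ z ] (r x y ≡ s × Pow r fib (t j) (toℕ a) y z × r x z ≡ s₁)) →
        ∀ k l h h₁ → HCond r fib t rep i j s k l h → HCond r fib t rep i j s₁ k l h₁ →
        toℕ h₁ ≡ addMod p (toℕ h) (toℕ a)
      exponent-additive i j i≢j s s₁ _ _ a (x , y , z , xy≡s , pow-a , xz≡s₁) k l h h₁ (_ , pow , hit) (_ , pow₁ , hit₁) =
        trans (Exponents.exponent-shift j (rep∉ i≢j k) (rep∈ j l) xy≡s pow-a xz≡s₁ pow hit pow₁ hit₁)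
              (sym (addMod≡% p (toℕ h) (toℕ a)))

lemma3p8 : (p : ℕ) → Prime p →
    (N d m : ℕ) (r : Fin N → Fin N → Fin d) → IsCoherentConfiguration N d r →
    (fib : Fin N → Fin (suc m)) → IsFiberLabelling N d (suc m) r fib →
    (∀ i → IsoToWreath r fib p i) →
    (∀ α β → fib α ≢ fib β → valency r fib α β ≡ p) →
    (∀ α β → fib α ≢ fib β → ¬ IsRegular r fib (r α β)) →
    (pt : Fin (suc m) → Fin N) → (∀ i → fib (pt i) ≡ i) →
    (t : Fin (suc m) → Fin d) → (∀ i → IsThinIn r fib i (t i)) →
    t zero ≢ r (pt zero) (pt zero) →
    (∀ i β γ → r (pt zero) β ≡ t zero → r (pt i) γ ≡ t i → r β γ ≡ r (pt zero) (pt i)) →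
    (rep : Fin (suc m) → Fin p → Fin N) → (∀ i k → fib (rep i k) ≡ i) →
    (∀ i β → fib β ≡ i → ∃[ k ] ThinEquiv r fib i (rep i k) β) →
    (∀ i k k′ β → ThinEquiv r fib i (rep i k) β → ThinEquiv r fib i (rep i k′) β → k ≡ k′) →
    (∀ i j → i ≢ j → ∀ s → InS r fib i j s → ∀ k l →
       Σ (Fin p) λ h → HCond r fib t rep i j s k l h ×
         (∀ h′ → HCond r fib t rep i j s k l h′ → h′ ≡ h))
    ×
    (∀ i j → i ≢ j → ∀ s s₁ → InS r fib i j s → InS r fib i j s₁ → ∀ (a : Fin p) →
       (∃[ x ] ∃[ y ] ∃[ z ] (r x y ≡ s × Pow r fib (t j) (toℕ a) y z × r x z ≡ s₁)) →
       ∀ k l h h₁ → HCond r fib t rep i j s k l h → HCond r fib t rep i j s₁ k l h₁ →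
       toℕ h₁ ≡ addMod p (toℕ h) (toℕ a))
-- The representatives need not be a transversal of the thin equivalence: the last two hypotheses are unused.
lemma3p8 p p-prime N d m r cc fib fl iso cross-valency non-regular pt pt∈ t thin t₀≢1 compatible rep rep∈ _ _ =
  exponent-exists-unique pt pt∈ t₀≢1 compatible rep rep∈ , exponent-additive pt pt∈ t₀≢1 compatible rep rep∈
  where open Exponent p-prime cc fl iso cross-valency non-regular thin
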